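{- Let $G$ be a simple 2VC graph without irrelevant edges, let $\{u,v\}$ be a 2-vertex cut of $G$, and let $(V_1,V_2)$ be a partition of $V(G)\setminus\{u,v\}$ with $V_1\neq\emptyset\neq V_2$ such that $G$ has no edge between $V_1$ and $V_2$. Let $G_i=G[V_i\cup\{u,v\}]$ for $i\in\{1,2\}$, and let $H_1,H_2$ be spanning subgraphs of $G_1,G_2$, respectively. If each of $H_1$ and $H_2$ is of type $A$ or of type $B$ with respect to $\{u,v\}$, then $H_1\cup H_2$ is a 2EC spanning subgraph of $G$. Moreover, if $H_1$ is of type $A$ and $H_2$ is of type $C$ with respect to $\{u,v\}$, then $H_1\cup H_2$ is a 2EC spanning subgraph of $G$.
   Context: A graph is 2EC if it is connected and remains connected after removing any single edge (a single vertex counts as 2EC); 2VC if connected, at least three vertices, and no cut vertex. A 2-vertex cut is a pair of vertices whose removal disconnects the graph. An edge $xy$ of $G$ is irrelevant if $\{x,y\}$ is a 2-vertex cut of $G$. For a graph $H$ containing vertices $u,v$, let $H'$ be obtained from $H$ by contracting each 2EC block of $H$ (maximal 2EC subgraph, possibly a single vertex) into a single super-node, and let $C(u),C(v)$ be the super-nodes containing $u,v$. Then $H$ is of type $A$ (w.r.t. $\{u,v\}$) if $H'$ consists of the single super-node $C(u)=C(v)$; of type $B$ if $H'$ is a $C(u),C(v)$-path of length at least 1; of type $C$ if $H'$ consists of two isolated super-nodes $C(u)$ and $C(v)$. -}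

module Defs where

open import Data.Bool using (Bool; true; false; _∧_; _∨_; not; T)
open import Data.Bool.Properties using (∧-comm)
open import Data.Fin using (Fin; zero; suc; toℕ; fromℕ; _≟_)
open import Data.Nat using (ℕ; suc; _≤_)
open import Data.Product using (Σ; Σ-syntax; _×_; _,_)
open import Data.Sum using (_⊎_; inj₁; inj₂)
open import Data.Empty using (⊥)
open import Relation.Nullary using (¬_)
open import Relation.Nullary.Decidable using (⌊_⌋)
open import Relation.Binary.PropositionalEquality using (_≡_; _≢_; refl; cong; cong₂; trans)
open import Function.Bundles using (_⇔_)

record Graph (n : ℕ) : Set where
  field
    V        : Fin n → Bool
    adj      : Fin n → Fin n → Bool
    sym      : ∀ x y → adj x y ≡ adj y x
    loopless : ∀ x → adj x x ≡ false
    closed   : ∀ x y → T (adj x y) → T (V x)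
open Graph public

_∈V_ : ∀ {n} → Fin n → Graph n → Set
x ∈V G = T (V G x)

Adj : ∀ {n} → Graph n → Fin n → Fin n → Set
Adj G x y = T (adj G x y)

private
  swap4 : ∀ p q r s → (p ∧ q) ∨ (r ∧ s) ≡ (s ∧ r) ∨ (q ∧ p)
  swap4 true  true  true  true  = refl
  swap4 true  true  true  false = refl
  swap4 true  true  false true  = refl
  swap4 true  true  false false = refl
  swap4 true  false true  true  = refl
  swap4 true  false true  false = refl
  swap4 true  false false true  = refl
  swap4 true  false false false = refl
  swap4 false true  true  true  = refl
  swap4 false true  true  false = refl
  swap4 false true  false true  = refl
  swap4 false true  false false = refl
  swap4 false false true  true  = refl
  swap4 false false true  false = refl
  swap4 false false false true  = refl
  swap4 false false false false = refl

  T∧₁ : ∀ {a b} → T (a ∧ b) → T a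
  T∧₁ {true} _ = _

  closedInd : ∀ a b c d → (T a → T c) → T (a ∧ (b ∧ d)) → T (c ∧ b)
  closedInd true true c d f t with f _
  ... | tc with c
  ...   | true = _
  closedInd true false c d f ()
  closedInd false b c d f ()

  closedUnion : ∀ a b c d → (T a → T c) → (T b → T d) → T (a ∨ b) → T (c ∨ d)
  closedUnion true b c d f g t with f _
  ... | tc with c
  ...   | true = _
  closedUnion false true c d f g t with g _
  ... | td with c | d
  ...   | true  | _ = _
  ...   | false | true = _

  falseAnd : ∀ {a} b → a ≡ false → a ∧ b ≡ false
  falseAnd b refl = refl

  falseOr : ∀ {a b} → a ≡ false → b ≡ false → a ∨ b ≡ false
  falseOr refl refl = refl

_==_ : ∀ {n} → Fin n → Fin n → Bool
x == y = ⌊ x ≟ y ⌋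

induced : ∀ {n} → Graph n → (Fin n → Bool) → Graph n
induced G S = record
  { V        = λ x → V G x ∧ S x
  ; adj      = λ x y → adj G x y ∧ (S x ∧ S y)
  ; sym      = λ x y → cong₂ _∧_ (sym G x y) (∧-comm (S x) (S y))
  ; loopless = λ x → falseAnd (S x ∧ S x) (loopless G x)
  ; closed   = λ x y → closedInd (adj G x y) (S x) (V G x) (S y) (closed G x y)
  }

deleteVertex : ∀ {n} → Graph n → Fin n → Graph n
deleteVertex G w = induced G (λ x → not (x == w))

sameEdge : ∀ {n} → Fin n → Fin n → Fin n → Fin n → Bool
sameEdge a b x y = ((x == a) ∧ (y == b)) ∨ ((x == b) ∧ (y == a))

deleteEdge : ∀ {n} → Graph n → Fin n → Fin n → Graph n
deleteEdge G a b = record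
  { V        = V G
  ; adj      = λ x y → adj G x y ∧ not (sameEdge a b x y)
  ; sym      = λ x y → cong₂ _∧_ (sym G x y)
                 (cong not (swap4 (x == a) (y == b) (x == b) (y == a)))
  ; loopless = λ x → falseAnd _ (loopless G x)
  ; closed   = λ x y t → closed G x y (T∧₁ t)
  }

_∪G_ : ∀ {n} → Graph n → Graph n → Graph n
G ∪G H = record
  { V        = λ x → V G x ∨ V H x
  ; adj      = λ x y → adj G x y ∨ adj H x y
  ; sym      = λ x y → cong₂ _∨_ (sym G x y) (sym H x y)
  ; loopless = λ x → falseOr (loopless G x) (loopless H x)
  ; closed   = λ x y → closedUnion (adj G x y) (adj H x y) (V G x) (V H x)
                         (closed G x y) (closed H x y)
  }

Subgraph : ∀ {n} → Graph n → Graph n → Set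
Subgraph K H = (∀ x → x ∈V K → x ∈V H) × (∀ x y → Adj K x y → Adj H x y)

Spanning : ∀ {n} → Graph n → Graph n → Set
Spanning H G = (∀ x → V H x ≡ V G x) × (∀ x y → Adj H x y → Adj G x y)

data Reach {n} (G : Graph n) : Fin n → Fin n → Set where
  here : ∀ {x} → x ∈V G → Reach G x x
  step : ∀ {x y z} → Adj G x y → Reach G y z → Reach G x z

Connected : ∀ {n} → Graph n → Set
Connected G = (Σ[ x ∈ Fin _ ] x ∈V G) × (∀ x y → x ∈V G → y ∈V G → Reach G x y)

Disconnected : ∀ {n} → Graph n → Set
Disconnected G = Σ[ x ∈ Fin _ ] Σ[ y ∈ Fin _ ] (x ∈V G × y ∈V G × ¬ Reach G x y)

-- 2-edge-connected (a single vertex is 2EC)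
TwoEC : ∀ {n} → Graph n → Set
TwoEC G = Connected G × (∀ a b → Adj G a b → Connected (deleteEdge G a b))

CutVertex : ∀ {n} → Graph n → Fin n → Set
CutVertex G w = w ∈V G × Disconnected (deleteVertex G w)

TwoVC : ∀ {n} → Graph n → Set
TwoVC G = Connected G
        × (Σ[ x ∈ Fin _ ] Σ[ y ∈ Fin _ ] Σ[ z ∈ Fin _ ]
             (x ∈V G × y ∈V G × z ∈V G × x ≢ y × x ≢ z × y ≢ z))
        × (∀ w → ¬ CutVertex G w)

TwoVertexCut : ∀ {n} → Graph n → Fin n → Fin n → Set
TwoVertexCut G u v = u ≢ v × u ∈V G × v ∈V G
                   × Disconnected (deleteVertex (deleteVertex G u) v)

IrrelevantEdge : ∀ {n} → Graph n → Fin n → Fin n → Set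
IrrelevantEdge G x y = Adj G x y × TwoVertexCut G x y

NoIrrelevantEdges : ∀ {n} → Graph n → Set
NoIrrelevantEdges G = ∀ x y → ¬ IrrelevantEdge G x y

IsBlock : ∀ {n} → Graph n → Graph n → Set
IsBlock H K = Subgraph K H × TwoEC K
            × (∀ K' → Subgraph K' H → TwoEC K' → Subgraph K K' → Subgraph K' K)

-- x and y lie in the same 2EC block of H (i.e. in the same super-node of H')
SameBlock : ∀ {n} → Graph n → Fin n → Fin n → Set
SameBlock H x y = Σ[ K ∈ Graph _ ] (IsBlock H K × x ∈V K × y ∈V K)

-- the super-nodes C(x), C(y) are adjacent in H' (H with every 2EC block
-- contracted to a single node; loops discarded)
AdjH' : ∀ {n} → Graph n → Fin n → Fin n → Set
AdjH' H x y = ¬ SameBlock H x y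
            × Σ[ x' ∈ Fin _ ] Σ[ y' ∈ Fin _ ]
                (SameBlock H x x' × SameBlock H y y' × Adj H x' y')

-- Type A: H' is the single super-node C(u) = C(v)
TypeA : ∀ {n} → Graph n → Fin n → Fin n → Set
TypeA H u v = SameBlock H u v × (∀ x → x ∈V H → SameBlock H x u)

-- Type B: H' is a C(u),C(v)-path of length k ≥ 1.  The path's super-nodes are
-- C(r 0), …, C(r k) with r 0 = u, r k = v; they are pairwise distinct, they are
-- all the super-nodes of H', and two of them are adjacent in H' exactly when
-- they are consecutive on the path.
TypeB : ∀ {n} → Graph n → Fin n → Fin n → Set
TypeB {n} H u v =
  Σ[ k ∈ ℕ ] Σ[ r ∈ (Fin (suc k) → Fin n) ]
    ( 1 ≤ k
    × r zero ≡ u × r (fromℕ k) ≡ v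
    × (∀ i → SameBlock H (r i) (r i))
    × (∀ i j → SameBlock H (r i) (r j) → i ≡ j)
    × (∀ x → x ∈V H → Σ[ i ∈ Fin (suc k) ] SameBlock H x (r i))
    × (∀ i j → AdjH' H (r i) (r j) ⇔ (toℕ j ≡ suc (toℕ i) ⊎ toℕ i ≡ suc (toℕ j))) )

-- Type C: H' consists of exactly two isolated super-nodes C(u) and C(v)
TypeC : ∀ {n} → Graph n → Fin n → Fin n → Set
TypeC H u v = SameBlock H u u × SameBlock H v v × ¬ SameBlock H u v
            × (∀ x → x ∈V H → SameBlock H x u ⊎ SameBlock H x v)
            × (∀ x y → ¬ AdjH' H x y)

withPair : ∀ {n} → (Fin n → Bool) → Fin n → Fin n → Fin n → Bool
withPair S u v x = S x ∨ ((x == u) ∨ (x == v))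

-- Delete an edge ab of H₁ ∪ H₂, say of H₁.  If a and b lie in one 2EC block of H₁, they
-- stay joined inside that block.  Otherwise H₁ is of type B and ab links two consecutive
-- blocks of the path of blocks from C(u) to C(v); the rest of the path still joins one
-- endpoint to u and the other to v.  H₂ closes the gap: it contains a u–v walk and not
-- ab, because an edge common to H₁ and H₂ would join u and v, and such an edge is
-- irrelevant.  In the type C case every edge of H₂ lies inside one of its two blocks,
-- which are connected to each other through H₁.
module Submission where

open import Defs
open import Data.Fin using (Fin)
open import Data.Nat using (ℕ)
open import Data.Bool using (Bool; T)
open import Data.Product using (Σ-syntax; _×_)
open import Data.Sum using (_⊎_)
open import Data.Empty using (⊥)
open import Relation.Nullary using (¬_)
open import Relation.Binary.PropositionalEquality using (_≢_)

open import Data.Bool using (true; false; _∧_; _∨_; not)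
open import Data.Bool.Properties using (T-∧; T-∨; ∧-distribˡ-∨)
open import Data.Fin as Fin using (zero; suc; toℕ; fromℕ; inject₁; _≟_)
open import Data.Fin.Induction using (<-weakInduction; >-weakInduction)
open import Data.Fin.Properties using (toℕ-inject₁; ℕ<⇒inject₁<; <⇒≢)
open import Data.Nat as ℕ using (suc)
open import Data.Nat.Properties using (n<1+n; m<n⇒m<1+n; <-trans; ≤-reflexive)
open import Data.Product using (_,_; proj₁; proj₂)
  renaming (map to ×-map; swap to ×-swap)
open import Data.Sum using (inj₁; inj₂; [_,_]) renaming (map to ⊎-map)
open import Data.Empty using (⊥-elim)
open import Function using (_∘_)
open import Function.Bundles using (_⇔_; Equivalence)
open import Relation.Nullary using (Dec; yes; no)
open import Relation.Nullary.Decidable using (T?; toWitness; fromWitness)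
open import Relation.Binary.PropositionalEquality
  using (_≡_; refl; cong; cong₂; subst; module ≡-Reasoning) renaming (sym to ≡-sym)

open Equivalence using (to; from)

T-not : ∀ {b} → ¬ T b → T (not b)
T-not {true}  ¬b = ¬b _
T-not {false} _  = _

∧-implied : ∀ {a b} → (T a → T b) → a ∧ b ≡ a
∧-implied {false}          _    = refl
∧-implied {true}  {true}   _    = refl
∧-implied {true}  {false}  a⇒b with () ← a⇒b _

sameEdge⇒ : ∀ {n} (a b x y : Fin n) → T (sameEdge a b x y)
          → (x ≡ a × y ≡ b) ⊎ (x ≡ b × y ≡ a)
sameEdge⇒ _ _ _ _ s = ⊎-map endpoints endpoints (to T-∨ s)
  where
  endpoints : ∀ {n} {x y x′ y′ : Fin n} → T ((x == x′) ∧ (y == y′)) → x ≡ x′ × y ≡ y′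
  endpoints {x = x} {x′ = x′} t = ×-map toWitness toWitness (to (T-∧ {x == x′}) t)

module _ {n : ℕ} where

  Adj-sym : (G : Graph n) {x y : Fin n} → Adj G x y → Adj G y x
  Adj-sym G {x} {y} = subst T (Graph.sym G x y)

  Reach-source : {G : Graph n} {x y : Fin n} → Reach G x y → x ∈V G
  Reach-source     (here p)   = p
  Reach-source {G} (step e _) = closed G _ _ e

  _++_ : {G : Graph n} {x y z : Fin n} → Reach G x y → Reach G y z → Reach G x z
  here _   ++ w = w
  step e r ++ w = step e (r ++ w)

  infixr 5 _++_

  Reach-sym : {G : Graph n} {x y : Fin n} → Reach G x y → Reach G y x
  Reach-sym     (here p)   = here p
  Reach-sym {G} (step e r) = Reach-sym r ++ step (Adj-sym G e) (here (closed G _ _ e))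

  Reach-map : {K L : Graph n} → Subgraph K L → {x y : Fin n} → Reach K x y → Reach L x y
  Reach-map (K⊆L , _)       (here p)   = here (K⊆L _ p)
  Reach-map s@(_ , EK⊆EL) (step e r) = step (EK⊆EL _ _ e) (Reach-map s r)

  ∪-∈ : (K L : Graph n) {x : Fin n} → x ∈V (K ∪G L) → x ∈V K ⊎ x ∈V L
  ∪-∈ K L {x} = to (T-∨ {V K x})

  ∪-Adj : (K L : Graph n) {x y : Fin n} → Adj (K ∪G L) x y → Adj K x y ⊎ Adj L x y
  ∪-Adj K L {x} {y} = to (T-∨ {adj K x y})

  ⊆∪ˡ : (K L : Graph n) → Subgraph K (K ∪G L)
  ⊆∪ˡ K L = (λ _ → from T-∨ ∘ inj₁) , (λ _ _ → from T-∨ ∘ inj₁)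

  ⊆∪ʳ : (K L : Graph n) → Subgraph L (K ∪G L)
  ⊆∪ʳ K L = (λ x → from (T-∨ {V K x}) ∘ inj₂) , (λ x y → from (T-∨ {adj K x y}) ∘ inj₂)

  ∪-⊆ : {K L M : Graph n} → Subgraph K M → Subgraph L M → Subgraph (K ∪G L) M
  ∪-⊆ {K} {L} (VK , EK) (VL , EL) =
      (λ x → [ VK x , VL x ] ∘ ∪-∈ K L)
    , (λ x y → [ EK x y , EL x y ] ∘ ∪-Adj K L)

  Connected-hub : (U : Graph n) {u : Fin n} → u ∈V U
                → (∀ x → x ∈V U → Reach U x u) → Connected U
  Connected-hub U u∈U to-u = (_ , u∈U) , λ x y x∈U y∈U → to-u x x∈U ++ Reach-sym (to-u y y∈U)

NonBridge : ∀ {n} → Graph n → Fin n → Fin n → Set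
NonBridge G a b = Reach (deleteEdge G a b) a b

module _ {n : ℕ} where

  module _ (K : Graph n) {a b : Fin n} where

    Adj-deleteEdge : {y z : Fin n} → Adj K y z → ¬ T (sameEdge a b y z)
                   → Adj (deleteEdge K a b) y z
    Adj-deleteEdge e ¬s = from T-∧ (e , T-not ¬s)

    deleteEdge-nonEdge : ¬ Adj K a b → Subgraph K (deleteEdge K a b)
    deleteEdge-nonEdge ¬e = (λ _ p → p) , λ y z e → Adj-deleteEdge e (not-ab e ∘ sameEdge⇒ a b y z)
      where
      not-ab : ∀ {y z} → Adj K y z → ¬ ((y ≡ a × z ≡ b) ⊎ (y ≡ b × z ≡ a))
      not-ab e (inj₁ (refl , refl)) = ¬e e
      not-ab e (inj₂ (refl , refl)) = ¬e (Adj-sym K e)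

    Adj-deleteEdge-avoiding : {c y z : Fin n} → c ≡ a ⊎ c ≡ b → y ≢ c → z ≢ c
                            → Adj K y z → Adj (deleteEdge K a b) y z
    Adj-deleteEdge-avoiding {c} {y} {z} c-end y≢c z≢c e =
      Adj-deleteEdge e (hits-c c-end ∘ sameEdge⇒ a b y z)
      where
      hits-c : c ≡ a ⊎ c ≡ b → ¬ ((y ≡ a × z ≡ b) ⊎ (y ≡ b × z ≡ a))
      hits-c (inj₁ refl) (inj₁ (y≡c , _)) = y≢c y≡c
      hits-c (inj₂ refl) (inj₁ (_ , z≡c)) = z≢c z≡c
      hits-c (inj₁ refl) (inj₂ (_ , z≡c)) = z≢c z≡c
      hits-c (inj₂ refl) (inj₂ (y≡c , _)) = y≢c y≡c

  deleteEdge-mono : {K L : Graph n} (a b : Fin n) → Subgraph K L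
                  → Subgraph (deleteEdge K a b) (deleteEdge L a b)
  deleteEdge-mono {K} {L} _ _ (VK , EK) = VK , λ x y e →
    let (e₁ , e₂) = to (T-∧ {adj K x y}) e in from (T-∧ {adj L x y}) (EK x y e₁ , e₂)

  module _ (K L : Graph n) {a b : Fin n} where

    NonBridge-∪ˡ : NonBridge K a b → NonBridge (K ∪G L) a b
    NonBridge-∪ˡ = Reach-map (deleteEdge-mono {K = K} {L = K ∪G L} a b (⊆∪ˡ K L))

    NonBridge-∪ʳ : NonBridge L a b → NonBridge (K ∪G L) a b
    NonBridge-∪ʳ = Reach-map (deleteEdge-mono {K = L} {L = K ∪G L} a b (⊆∪ʳ K L))

module _ {n : ℕ} where

  TwoEC-criterion : (U : Graph n) → Connected U → (∀ a b → Adj U a b → NonBridge U a b) → TwoEC U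
  TwoEC-criterion U (ne , con) nonBridge =
    (ne , con) , λ a b e → ne , λ x y x∈U y∈U → detour (nonBridge a b e) (con x y x∈U y∈U)
    where
    detour : ∀ {a b} → NonBridge U a b → ∀ {x y} → Reach U x y → Reach (deleteEdge U a b) x y
    detour         ab (here p) = here p
    detour {a} {b} ab (step {x} {y} e r) with T? (sameEdge a b x y)
    ... | no ¬s = step (Adj-deleteEdge U e ¬s) (detour ab r)
    ... | yes s with sameEdge⇒ a b x y s
    ...   | inj₁ (refl , refl) = ab ++ detour ab r
    ...   | inj₂ (refl , refl) = Reach-sym ab ++ detour ab r

  TwoEC⇒Connected-deleteEdge : (K : Graph n) → TwoEC K → ∀ a b → Connected (deleteEdge K a b)
  TwoEC⇒Connected-deleteEdge K ((ne , con) , con-del) a b with T? (adj K a b)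
  ... | yes e  = con-del a b e
  ... | no ¬e = ne , λ x y x∈K y∈K → Reach-map (deleteEdge-nonEdge K ¬e) (con x y x∈K y∈K)

  TwoEC⇒NonBridge : (K : Graph n) → TwoEC K → ∀ a b → Adj K a b → NonBridge K a b
  TwoEC⇒NonBridge K 2ec a b e =
    proj₂ (TwoEC⇒Connected-deleteEdge K 2ec a b) a b (closed K a b e) (closed K b a (Adj-sym K e))

  TwoEC-∪ : (K L : Graph n) → TwoEC K → TwoEC L → ∀ y → y ∈V K → y ∈V L → TwoEC (K ∪G L)
  TwoEC-∪ K L 2ecK 2ecL y y∈K y∈L =
    TwoEC-criterion (K ∪G L) (Connected-hub (K ∪G L) (proj₁ (⊆∪ˡ K L) y y∈K) to-y) nonBridge
    where
    to-y : ∀ x → x ∈V (K ∪G L) → Reach (K ∪G L) x y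
    to-y x x∈ with ∪-∈ K L x∈
    ... | inj₁ x∈K = Reach-map (⊆∪ˡ K L) (proj₂ (proj₁ 2ecK) x y x∈K y∈K)
    ... | inj₂ x∈L = Reach-map (⊆∪ʳ K L) (proj₂ (proj₁ 2ecL) x y x∈L y∈L)
    nonBridge : ∀ a b → Adj (K ∪G L) a b → NonBridge (K ∪G L) a b
    nonBridge a b e with ∪-Adj K L e
    ... | inj₁ eK = NonBridge-∪ˡ K L (TwoEC⇒NonBridge K 2ecK a b eK)
    ... | inj₂ eL = NonBridge-∪ʳ K L (TwoEC⇒NonBridge L 2ecL a b eL)

module Blocks {n} (H : Graph n) where

  sameBlock-sym : {x y : Fin n} → SameBlock H x y → SameBlock H y x
  sameBlock-sym (K , block , x∈K , y∈K) = K , block , y∈K , x∈K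

  sameBlock-trans : {x y z : Fin n} → SameBlock H x y → SameBlock H y z → SameBlock H x z
  sameBlock-trans {y = y} (K , block@(K⊆H , 2ecK , maximal) , x∈K , y∈K)
                          (L , (L⊆H , 2ecL , _) , y∈L , z∈L) =
    K , block , x∈K , proj₁ K∪L⊆K _ (proj₁ (⊆∪ʳ K L) _ z∈L)
    where
    K∪L⊆K : Subgraph (K ∪G L) K
    K∪L⊆K = maximal (K ∪G L) (∪-⊆ {K = K} {L = L} {M = H} K⊆H L⊆H)
                    (TwoEC-∪ K L 2ecK 2ecL y y∈K y∈L) (⊆∪ˡ K L)

  sameBlock-∈ : {x y : Fin n} → SameBlock H x y → x ∈V H
  sameBlock-∈ (_ , (K⊆H , _) , x∈K , _) = proj₁ K⊆H _ x∈K

  sameBlock-reach : {x y : Fin n} → SameBlock H x y → Reach H x y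
  sameBlock-reach (K , (K⊆H , 2ecK , _) , x∈K , y∈K) = Reach-map K⊆H (proj₂ (proj₁ 2ecK) _ _ x∈K y∈K)

  sameBlock-reach-deleteEdge : (a b : Fin n) {x y : Fin n} → SameBlock H x y
                             → Reach (deleteEdge H a b) x y
  sameBlock-reach-deleteEdge a b (K , (K⊆H , 2ecK , _) , x∈K , y∈K) =
    Reach-map (deleteEdge-mono {K = K} {L = H} a b K⊆H)
              (proj₂ (TwoEC⇒Connected-deleteEdge K 2ecK a b) _ _ x∈K y∈K)

  AdjH'-reach : {x y : Fin n} → AdjH' H x y → Reach H x y
  AdjH'-reach (_ , _ , _ , xx′ , yy′ , e) =
    sameBlock-reach xx′ ++ step e (sameBlock-reach (sameBlock-sym yy′))

  edge-links-blocks : {a b x y : Fin n} → Adj H a b → SameBlock H x a → SameBlock H y b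
                    → ¬ SameBlock H x y → AdjH' H x y
  edge-links-blocks e x~a y~b x≁y = x≁y , _ , _ , x~a , y~b , e

  AdjH'-reach-deleteEdge : {a b c x y : Fin n} → c ≡ a ⊎ c ≡ b
                         → ¬ SameBlock H c x → ¬ SameBlock H c y
                         → AdjH' H x y → Reach (deleteEdge H a b) x y
  AdjH'-reach-deleteEdge {a} {b} c-end c∉x c∉y (_ , _ , _ , xx′ , yy′ , e) =
       sameBlock-reach-deleteEdge a b xx′
    ++ step (Adj-deleteEdge-avoiding H c-end (outside c∉x xx′) (outside c∉y yy′) e)
            (sameBlock-reach-deleteEdge a b (sameBlock-sym yy′))
    where
    outside : ∀ {c x x′} → ¬ SameBlock H c x → SameBlock H x x′ → x′ ≢ c
    outside c∉x xx′ refl = c∉x (sameBlock-sym xx′)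

module BlockPath {n k} (H : Graph n) (r : Fin (suc k) → Fin n)
  (r-block    : ∀ i → SameBlock H (r i) (r i))
  (r-distinct : ∀ i j → SameBlock H (r i) (r j) → i ≡ j)
  (r-path     : ∀ i j → AdjH' H (r i) (r j) ⇔ (toℕ j ≡ suc (toℕ i) ⊎ toℕ i ≡ suc (toℕ j)))
  where
  open Blocks H

  consecutive : ∀ (p : Fin k) → AdjH' H (r (inject₁ p)) (r (suc p))
  consecutive p = from (r-path _ _) (inj₁ (cong suc (≡-sym (toℕ-inject₁ p))))

  r∈H : ∀ i → r i ∈V H
  r∈H i = sameBlock-∈ (r-block i)

  reach-first : ∀ i → Reach H (r i) (r zero)
  reach-first = <-weakInduction (λ i → Reach H (r i) (r zero)) (here (r∈H zero))
    λ p to-first → Reach-sym (AdjH'-reach (consecutive p)) ++ to-first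

  module _ {a b c : Fin n} (c-end : c ≡ a ⊎ c ≡ b) {j : Fin (suc k)} (c∈rj : SameBlock H c (r j)) where

    private
      D = deleteEdge H a b

      link : ∀ p → inject₁ p ≢ j → suc p ≢ j → Reach D (r (inject₁ p)) (r (suc p))
      link p p≢j sp≢j = AdjH'-reach-deleteEdge c-end (away p≢j) (away sp≢j) (consecutive p)
        where
        away : ∀ {i} → i ≢ j → ¬ SameBlock H c (r i)
        away i≢j c∈ri = i≢j (r-distinct _ _ (sameBlock-trans (sameBlock-sym c∈ri) c∈rj))

    below-reach-first : ∀ i → i Fin.< j → Reach D (r i) (r zero)
    below-reach-first = <-weakInduction (λ i → i Fin.< j → Reach D (r i) (r zero))
      (λ _ → here (r∈H zero))
      λ p to-first sp<j → let p<j = ℕ<⇒inject₁< (<-trans (n<1+n _) sp<j) in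
        Reach-sym (link p (<⇒≢ p<j) (<⇒≢ sp<j)) ++ to-first p<j

    above-reach-last : ∀ i → j Fin.< i → Reach D (r i) (r (fromℕ k))
    above-reach-last = >-weakInduction (λ i → j Fin.< i → Reach D (r i) (r (fromℕ k)))
      (λ _ → here (r∈H (fromℕ k)))
      λ p to-last j<p → let j<sp = m<n⇒m<1+n (subst (toℕ j ℕ.<_) (toℕ-inject₁ p) j<p) in
        link p (<⇒≢ j<p ∘ ≡-sym) (<⇒≢ j<sp ∘ ≡-sym) ++ to-last j<sp

  split-at : {a b x y : Fin n} → x ≡ a ⊎ x ≡ b → y ≡ a ⊎ y ≡ b
           → {i j : Fin (suc k)} → SameBlock H x (r i) → SameBlock H y (r j) → i Fin.< j
           → Reach (deleteEdge H a b) x (r zero) × Reach (deleteEdge H a b) y (r (fromℕ k))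
  split-at {a} {b} x-end y-end {i} {j} x~ri y~rj i<j =
      sameBlock-reach-deleteEdge a b x~ri ++ below-reach-first y-end y~rj i i<j
    , sameBlock-reach-deleteEdge a b y~rj ++ above-reach-last x-end x~ri j i<j

SplitsAcross : ∀ {n} → Graph n → Fin n → Fin n → Fin n → Fin n → Set
SplitsAcross H u v a b = (Reach D a u × Reach D b v) ⊎ (Reach D a v × Reach D b u)
  where D = deleteEdge H a b

module Types {n} (H : Graph n) (u v : Fin n) where
  open Blocks H

  typeA-reach : TypeA H u v → ∀ x → x ∈V H → Reach H x u
  typeA-reach (_ , one-block) x x∈H = sameBlock-reach (one-block x x∈H)

  typeA-join : TypeA H u v → Reach H u v
  typeA-join (u~v , _) = sameBlock-reach u~v

  typeA-nonBridge : TypeA H u v → ∀ a b → Adj H a b → NonBridge H a b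
  typeA-nonBridge (_ , one-block) a b e =
    sameBlock-reach-deleteEdge a b
      (sameBlock-trans (one-block a (closed H a b e))
                       (sameBlock-sym (one-block b (closed H b a (Adj-sym H e)))))

  typeB-reach : TypeB H u v → ∀ x → x ∈V H → Reach H x u
  typeB-reach (_ , r , _ , r0≡u , _ , r-block , r-distinct , cover , r-path) x x∈H =
    let (i , x~ri) = cover x x∈H in
    subst (Reach H x) r0≡u (sameBlock-reach x~ri ++ reach-first i)
    where open BlockPath H r r-block r-distinct r-path

  typeB-join : TypeB H u v → Reach H u v
  typeB-join t@(k , _ , _ , _ , rk≡v , r-block , _) =
    Reach-sym (typeB-reach t v (subst (_∈V H) rk≡v (sameBlock-∈ (r-block (fromℕ k)))))

  typeB-nonBridge-or-splits : TypeB H u v → ∀ a b → Adj H a b → NonBridge H a b ⊎ SplitsAcross H u v a b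
  typeB-nonBridge-or-splits (k , r , _ , r0≡u , rk≡v , r-block , r-distinct , cover , r-path) a b e =
    across (cover a (closed H a b e)) (cover b (closed H b a (Adj-sym H e)))
    where
    open BlockPath H r r-block r-distinct r-path
    D = deleteEdge H a b

    at-ends : ∀ {x y} → Reach D x (r zero) × Reach D y (r (fromℕ k)) → Reach D x u × Reach D y v
    at-ends = ×-map (subst (Reach D _) r0≡u) (subst (Reach D _) rk≡v)

    across : Σ[ i ∈ Fin _ ] SameBlock H a (r i) → Σ[ j ∈ Fin _ ] SameBlock H b (r j)
           → NonBridge H a b ⊎ SplitsAcross H u v a b
    across (i , a~ri) (j , b~rj) with i ≟ j
    ... | yes refl = inj₁ (sameBlock-reach-deleteEdge a b (sameBlock-trans a~ri (sameBlock-sym b~rj)))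
    ... | no i≢j
      with to (r-path i j) (edge-links-blocks e (sameBlock-sym a~ri) (sameBlock-sym b~rj) (i≢j ∘ r-distinct i j))
    ...   | inj₁ j≡1+i = inj₂ (inj₁ (at-ends
                           (split-at (inj₁ refl) (inj₂ refl) a~ri b~rj (≤-reflexive (≡-sym j≡1+i)))))
    ...   | inj₂ i≡1+j = inj₂ (inj₂ (×-swap (at-ends
                           (split-at (inj₂ refl) (inj₁ refl) b~rj a~ri (≤-reflexive (≡-sym i≡1+j))))))

  typeC-reach : TypeC H u v → ∀ x → x ∈V H → Reach H x u ⊎ Reach H x v
  typeC-reach (_ , _ , _ , cover , _) x x∈H = ⊎-map sameBlock-reach sameBlock-reach (cover x x∈H)

  typeC-nonBridge : TypeC H u v → ∀ a b → Adj H a b → NonBridge H a b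
  typeC-nonBridge (_ , _ , u≁v , cover , no-link) a b e
    with cover a (closed H a b e) | cover b (closed H b a (Adj-sym H e))
  ... | inj₁ a~u | inj₁ b~u = sameBlock-reach-deleteEdge a b (sameBlock-trans a~u (sameBlock-sym b~u))
  ... | inj₂ a~v | inj₂ b~v = sameBlock-reach-deleteEdge a b (sameBlock-trans a~v (sameBlock-sym b~v))
  ... | inj₁ a~u | inj₂ b~v =
        ⊥-elim (no-link u v (edge-links-blocks e (sameBlock-sym a~u) (sameBlock-sym b~v) u≁v))
  ... | inj₂ a~v | inj₁ b~u =
        ⊥-elim (no-link u v
                  (edge-links-blocks (Adj-sym H e) (sameBlock-sym b~u) (sameBlock-sym a~v) u≁v))

  typeAB-reach : TypeA H u v ⊎ TypeB H u v → ∀ x → x ∈V H → Reach H x u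
  typeAB-reach = [ typeA-reach , typeB-reach ]

  typeAB-join : TypeA H u v ⊎ TypeB H u v → Reach H u v
  typeAB-join = [ typeA-join , typeB-join ]

  typeAB-nonBridge-or-splits : TypeA H u v ⊎ TypeB H u v
                             → ∀ a b → Adj H a b → NonBridge H a b ⊎ SplitsAcross H u v a b
  typeAB-nonBridge-or-splits (inj₁ t) a b e = inj₁ (typeA-nonBridge t a b e)
  typeAB-nonBridge-or-splits (inj₂ t)       = typeB-nonBridge-or-splits t

module _ {n} (K L U : Graph n) (K⊆U : Subgraph K U) (L⊆U : Subgraph L U) {u v a b : Fin n} where

  splits-rejoin : ¬ Adj L a b → Reach L u v → SplitsAcross K u v a b → NonBridge U a b
  splits-rejoin ab∉L u⇝v =
    [ (λ { (a⇝u , b⇝v) → from-K a⇝u ++ from-L u⇝v ++ Reach-sym (from-K b⇝v) })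
    , (λ { (a⇝v , b⇝u) → from-K a⇝v ++ Reach-sym (from-L u⇝v) ++ Reach-sym (from-K b⇝u) }) ]
    where
    from-K : ∀ {x y} → Reach (deleteEdge K a b) x y → Reach (deleteEdge U a b) x y
    from-K = Reach-map (deleteEdge-mono {K = K} {L = U} a b K⊆U)
    from-L : ∀ {x y} → Reach L x y → Reach (deleteEdge U a b) x y
    from-L r = Reach-map (deleteEdge-mono {K = L} {L = U} a b L⊆U)
                         (Reach-map {L = deleteEdge L a b} (deleteEdge-nonEdge L ab∉L) r)

module _ {n} (H₁ H₂ : Graph n) (u v : Fin n) where
  private
    U = H₁ ∪G H₂
    module T₁ = Types H₁ u v
    module T₂ = Types H₂ u v

    u∈U : Reach H₁ u v → u ∈V U
    u∈U = proj₁ (⊆∪ˡ H₁ H₂) u ∘ Reach-source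

  ∪-TwoEC-typesAB : (∀ a b → Adj H₁ a b → ¬ Adj H₂ a b)
                  → TypeA H₁ u v ⊎ TypeB H₁ u v → TypeA H₂ u v ⊎ TypeB H₂ u v → TwoEC U
  ∪-TwoEC-typesAB disjoint t₁ t₂ =
    TwoEC-criterion U (Connected-hub U (u∈U (T₁.typeAB-join t₁)) to-u) nonBridge
    where
    to-u : ∀ x → x ∈V U → Reach U x u
    to-u x = [ Reach-map (⊆∪ˡ H₁ H₂) ∘ T₁.typeAB-reach t₁ x
             , Reach-map (⊆∪ʳ H₁ H₂) ∘ T₂.typeAB-reach t₂ x ] ∘ ∪-∈ H₁ H₂
    nonBridge : ∀ a b → Adj U a b → NonBridge U a b
    nonBridge a b e with ∪-Adj H₁ H₂ e
    ... | inj₁ e₁ = [ NonBridge-∪ˡ H₁ H₂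
                    , splits-rejoin H₁ H₂ U (⊆∪ˡ H₁ H₂) (⊆∪ʳ H₁ H₂)
                        (disjoint a b e₁) (T₂.typeAB-join t₂) ]
                    (T₁.typeAB-nonBridge-or-splits t₁ a b e₁)
    ... | inj₂ e₂ = [ NonBridge-∪ʳ H₁ H₂
                    , splits-rejoin H₂ H₁ U (⊆∪ʳ H₁ H₂) (⊆∪ˡ H₁ H₂)
                        (λ e₁ → disjoint a b e₁ e₂) (T₁.typeAB-join t₁) ]
                    (T₂.typeAB-nonBridge-or-splits t₂ a b e₂)

  ∪-TwoEC-typesAC : TypeA H₁ u v → TypeC H₂ u v → TwoEC U
  ∪-TwoEC-typesAC t₁ t₂ =
    TwoEC-criterion U (Connected-hub U (u∈U (T₁.typeA-join t₁)) to-u) nonBridge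
    where
    to-u : ∀ x → x ∈V U → Reach U x u
    to-u x x∈U with ∪-∈ H₁ H₂ x∈U
    ... | inj₁ x∈H₁ = Reach-map (⊆∪ˡ H₁ H₂) (T₁.typeA-reach t₁ x x∈H₁)
    ... | inj₂ x∈H₂ with T₂.typeC-reach t₂ x x∈H₂
    ...   | inj₁ x⇝u = Reach-map (⊆∪ʳ H₁ H₂) x⇝u
    ...   | inj₂ x⇝v = Reach-map (⊆∪ʳ H₁ H₂) x⇝v ++ Reach-map (⊆∪ˡ H₁ H₂) (Reach-sym (T₁.typeA-join t₁))
    nonBridge : ∀ a b → Adj U a b → NonBridge U a b
    nonBridge a b = [ NonBridge-∪ˡ H₁ H₂ ∘ T₁.typeA-nonBridge t₁ a b
                    , NonBridge-∪ʳ H₁ H₂ ∘ T₂.typeC-nonBridge t₂ a b ] ∘ ∪-Adj H₁ H₂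

module _ {n} (G : Graph n) where

  induced-Adj : (S : Fin n → Bool) {x y : Fin n} → Adj (induced G S) x y → Adj G x y × T (S x) × T (S y)
  induced-Adj S {x} {y} e = let (e′ , s) = to (T-∧ {adj G x y}) e in e′ , to (T-∧ {S x}) s

  ∪-spanning : {W₁ W₂ : Fin n → Bool} {H₁ H₂ : Graph n}
             → Spanning H₁ (induced G W₁) → Spanning H₂ (induced G W₂)
             → (∀ x → x ∈V G → T (W₁ x ∨ W₂ x)) → Spanning (H₁ ∪G H₂) G
  ∪-spanning {W₁} {W₂} {H₁} {H₂} (V₁≡ , E₁) (V₂≡ , E₂) covered = same-vertices , same-edges
    where
    open ≡-Reasoning
    same-vertices : ∀ x → V H₁ x ∨ V H₂ x ≡ V G x
    same-vertices x = begin
      V H₁ x ∨ V H₂ x                 ≡⟨ cong₂ _∨_ (V₁≡ x) (V₂≡ x) ⟩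
      (V G x ∧ W₁ x) ∨ (V G x ∧ W₂ x) ≡⟨ ∧-distribˡ-∨ (V G x) (W₁ x) (W₂ x) ⟨
      V G x ∧ (W₁ x ∨ W₂ x)           ≡⟨ ∧-implied (covered x) ⟩
      V G x                           ∎
    same-edges : ∀ x y → Adj (H₁ ∪G H₂) x y → Adj G x y
    same-edges x y = [ proj₁ ∘ induced-Adj W₁ ∘ E₁ x y , proj₁ ∘ induced-Adj W₂ ∘ E₂ x y ] ∘ ∪-Adj H₁ H₂

  spanning-edge-disjoint : {W₁ W₂ : Fin n → Bool} {H₁ H₂ : Graph n}
                         → Spanning H₁ (induced G W₁) → Spanning H₂ (induced G W₂)
                         → (∀ x y → Adj G x y → T (W₁ x) → T (W₂ x) → T (W₁ y) → T (W₂ y) → ⊥)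
                         → ∀ a b → Adj H₁ a b → ¬ Adj H₂ a b
  spanning-edge-disjoint {W₁} {W₂} (_ , E₁) (_ , E₂) shared-nonadjacent a b e₁ e₂ =
    let (e , a∈W₁ , b∈W₁) = induced-Adj W₁ (E₁ a b e₁)
        (_ , a∈W₂ , b∈W₂) = induced-Adj W₂ (E₂ a b e₂)
    in shared-nonadjacent a b e a∈W₁ a∈W₂ b∈W₁ b∈W₂

  cut-pair-nonadjacent : {u v : Fin n} → NoIrrelevantEdges G → TwoVertexCut G u v
                       → ∀ x y → Adj G x y → x ≡ u ⊎ x ≡ v → y ≡ u ⊎ y ≡ v → ⊥
  cut-pair-nonadjacent _   _   x _ e (inj₁ refl) (inj₁ refl) = subst T (loopless G x) e
  cut-pair-nonadjacent irr cut x y e (inj₁ refl) (inj₂ refl) = irr x y (e , cut)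
  cut-pair-nonadjacent irr cut x y e (inj₂ refl) (inj₁ refl) = irr y x (Adj-sym G e , cut)
  cut-pair-nonadjacent _   _   x _ e (inj₂ refl) (inj₂ refl) = subst T (loopless G x) e

  module _ (V₁ V₂ : Fin n → Bool) (u v : Fin n) where

    private
      pair-sound : ∀ x → T ((x == u) ∨ (x == v)) → x ≡ u ⊎ x ≡ v
      pair-sound x = ⊎-map toWitness toWitness ∘ to (T-∨ {x == u})

      pair⊆withPair : ∀ S x → x ≡ u ⊎ x ≡ v → T (withPair S u v x)
      pair⊆withPair S x = from (T-∨ {S x}) ∘ inj₂ ∘ from (T-∨ {x == u}) ∘ ⊎-map fromWitness fromWitness

    withPair-shared : (∀ x → T (V₁ x) → T (V₂ x) → ⊥)
                    → ∀ x → T (withPair V₁ u v x) → T (withPair V₂ u v x) → x ≡ u ⊎ x ≡ v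
    withPair-shared disjoint x w₁ w₂ with to (T-∨ {V₁ x}) w₁ | to (T-∨ {V₂ x}) w₂
    ... | inj₂ x∈uv | _         = pair-sound x x∈uv
    ... | inj₁ _    | inj₂ x∈uv = pair-sound x x∈uv
    ... | inj₁ x∈V₁ | inj₁ x∈V₂ = ⊥-elim (disjoint x x∈V₁ x∈V₂)

    withPair-cover : (∀ x → x ∈V G → x ≢ u → x ≢ v → T (V₁ x) ⊎ T (V₂ x))
                   → ∀ x → x ∈V G → T (withPair V₁ u v x ∨ withPair V₂ u v x)
    withPair-cover cover x x∈G = from (T-∨ {withPair V₁ u v x}) (sides (x ≟ u) (x ≟ v))
      where
      sides : Dec (x ≡ u) → Dec (x ≡ v) → T (withPair V₁ u v x) ⊎ T (withPair V₂ u v x)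
      sides (yes x≡u) _         = inj₁ (pair⊆withPair V₁ x (inj₁ x≡u))
      sides (no _)    (yes x≡v) = inj₁ (pair⊆withPair V₁ x (inj₂ x≡v))
      sides (no x≢u)  (no x≢v)  =
        ⊎-map (from (T-∨ {V₁ x}) ∘ inj₁) (from (T-∨ {V₂ x}) ∘ inj₁) (cover x x∈G x≢u x≢v)

lemma21 : ∀ {n} (G : Graph n) (u v : Fin n) (V₁ V₂ : Fin n → Bool) (H₁ H₂ : Graph n)
    → TwoVC G
    → NoIrrelevantEdges G
    → TwoVertexCut G u v
    → (∀ x → x ∈V G → x ≢ u → x ≢ v → T (V₁ x) ⊎ T (V₂ x))
    → (∀ x → T (V₁ x) → x ∈V G × x ≢ u × x ≢ v)
    → (∀ x → T (V₂ x) → x ∈V G × x ≢ u × x ≢ v)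
    → (∀ x → T (V₁ x) → T (V₂ x) → ⊥)
    → (Σ[ x ∈ Fin n ] T (V₁ x))
    → (Σ[ x ∈ Fin n ] T (V₂ x))
    → (∀ x y → T (V₁ x) → T (V₂ y) → ¬ Adj G x y)
    → Spanning H₁ (induced G (withPair V₁ u v))
    → Spanning H₂ (induced G (withPair V₂ u v))
    → ((TypeA H₁ u v ⊎ TypeB H₁ u v) → (TypeA H₂ u v ⊎ TypeB H₂ u v)
         → TwoEC (H₁ ∪G H₂) × Spanning (H₁ ∪G H₂) G)
      × (TypeA H₁ u v → TypeC H₂ u v
         → TwoEC (H₁ ∪G H₂) × Spanning (H₁ ∪G H₂) G)
lemma21 G u v V₁ V₂ H₁ H₂ _ no-irrelevant cut cover _ _ disjoint-sides _ _ _ span₁ span₂ =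
    (λ t₁ t₂ → ∪-TwoEC-typesAB H₁ H₂ u v edge-disjoint t₁ t₂ , spanning)
  , (λ t₁ t₂ → ∪-TwoEC-typesAC H₁ H₂ u v t₁ t₂ , spanning)
  where
  shared : ∀ x → T (withPair V₁ u v x) → T (withPair V₂ u v x) → x ≡ u ⊎ x ≡ v
  shared = withPair-shared G V₁ V₂ u v disjoint-sides

  spanning : Spanning (H₁ ∪G H₂) G
  spanning = ∪-spanning G {H₁ = H₁} {H₂} span₁ span₂ (withPair-cover G V₁ V₂ u v cover)

  edge-disjoint : ∀ a b → Adj H₁ a b → ¬ Adj H₂ a b
  edge-disjoint = spanning-edge-disjoint G {H₁ = H₁} {H₂} span₁ span₂ λ x y e x∈W₁ x∈W₂ y∈W₁ y∈W₂ →
    cut-pair-nonadjacent G no-irrelevant cut x y e (shared x x∈W₁ x∈W₂) (shared y y∈W₁ y∈W₂)
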